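{- Let $A$ be a set with decidable equality and $f\colon A\to A$ a bijection with finite support. Let $s$ be a list enumerating $\mathrm{supp}(f)$ without repetitions and $N=|\mathrm{supp}(f)|$. Then $R=\mathrm{cycles}_f(N,s,[])$ is a list of closed prefixes for $f$, and $\mathrm{fromFP}(\mathrm{toFP}^*(R))\,a=f\,a$ for all $a\in A$.
   Context: $\mathrm{supp}(f)=\{x\in A\mid f\,x\neq x\}$. The transposition $(x\ y)$ swaps $x,y$ and fixes everything else. $a:\rho$ denotes the sequence with first element $a$ followed by $\rho$; $\rho[c]$ denotes $\rho$ with $c$ appended at the end; $\mathrm{last}(\rho)$ is the last element. $\mathrm{toFP}(a,[])=[]$, $\mathrm{toFP}(a,b:\rho')=(a,b):\mathrm{toFP}(b,\rho')$. $\mathrm{fromFP}([])=\mathrm{id}$, $\mathrm{fromFP}((a,b):as')=(a\ b)\circ\mathrm{fromFP}(as')$ (right-hand function applied first). A non-empty sequence $\rho=[a_1,\ldots,a_n]$ is a prefix with head $a_0$ for $f$ if $a_0\in\mathrm{supp}(f)$, $f\,a_i=a_{i+1}$ for $0\le i<n$, and $a_0$ does not occur in $\rho$; it is closed if $f\,a_n=a_0$. Define $\mathrm{cycle}_f(0,a)=[f\,a]$ and $\mathrm{cycle}_f(n+1,a)=\rho$ if $f\,b=a$, and $=\rho[f\,b]$ otherwise, where $\rho=\mathrm{cycle}_f(n,a)$ and $b=\mathrm{last}(\rho)$. For a list $R$ of sequences let $\bigcup R$ be the set of elements occurring in them; define $\mathrm{cycles}_f(n,[],R)=R$ and $\mathrm{cycles}_f(n,a:as,R)=\mathrm{cycles}_f(n,as,R)$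 if $a\in\bigcup R$, and $=\mathrm{cycles}_f(n,as,(a:\mathrm{cycle}_f(n,a)):R)$ otherwise. A list $R$ of sequences is a list of closed prefixes for $f$ if each entry has the form $a:\rho$ with $\rho$ a closed prefix with head $a$ for $f$ and distinct entries have no element in common. For such $R$, $\mathrm{toFP}^*(R)$ is the concatenation, in list order, of $\mathrm{toFP}(a,\rho)$ over the entries $a:\rho$ of $R$. -}

module Defs where

open import Data.Nat using (ℕ; zero; suc)
open import Data.Product using (Σ; ∃; ∃₂; _×_; _,_)
open import Data.List using (List; []; _∷_; _++_; _∷ʳ_; concat)
open import Data.List.NonEmpty as List⁺ using (List⁺; [_])
open import Data.List.Membership.Propositional using (_∈_; _∉_)
open import Data.List.Relation.Unary.All using (All)
open import Data.List.Relation.Unary.AllPairs using (AllPairs)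
open import Data.List.Relation.Unary.Linked using (Linked)
open import Data.List.Relation.Binary.Disjoint.Propositional using (Disjoint)
open import Relation.Binary.Definitions using (DecidableEquality)
open import Relation.Binary.PropositionalEquality using (_≡_; _≢_)
open import Relation.Nullary using (yes; no)
import Data.List.Membership.DecPropositional

module Perm {A : Set} (_≟_ : DecidableEquality A) where

  InSupp : (A → A) → A → Set
  InSupp f x = f x ≢ x

  swap : A → A → A → A
  swap x y z with z ≟ x
  ... | yes _ = y
  ... | no _ with z ≟ y
  ...   | yes _ = x
  ...   | no _ = z

  toFP : A → List A → List (A × A)
  toFP a [] = []
  toFP a (b ∷ ρ) = (a , b) ∷ toFP b ρ

  -- right-hand function applied first
  fromFP : List (A × A) → A → A
  fromFP [] z = z
  fromFP ((a , b) ∷ as) z = swap a b (fromFP as z)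

  module _ (f : A → A) where

    IsPrefix : A → List A → Set
    IsPrefix a₀ ρ = (ρ ≢ []) × InSupp f a₀
                  × Linked (λ x y → f x ≡ y) (a₀ ∷ ρ) × (a₀ ∉ ρ)

    IsClosedPrefix : A → List A → Set
    IsClosedPrefix a₀ ρ = IsPrefix a₀ ρ
                        × ∃₂ λ ρ′ aₙ → (ρ ≡ ρ′ ∷ʳ aₙ) × (f aₙ ≡ a₀)

    cycle : ℕ → A → List⁺ A
    cycle zero a = [ f a ]
    cycle (suc n) a with cycle n a
    ... | ρ with f (List⁺.last ρ) ≟ a
    ...   | yes _ = ρ
    ...   | no _ = ρ List⁺.⁺∷ʳ f (List⁺.last ρ)

    cycles : ℕ → List A → List (List A) → List (List A)
    cycles n [] R = R
    cycles n (a ∷ as) R with Data.List.Membership.DecPropositional._∈?_ _≟_ a (concat R)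
    ... | yes _ = cycles n as R
    ... | no _ = cycles n as ((a ∷ List⁺.toList (cycle n a)) ∷ R)

    IsClosedPrefixList : List (List A) → Set
    IsClosedPrefixList R =
      All (λ e → ∃₂ λ a ρ → (e ≡ a ∷ ρ) × IsClosedPrefix a ρ) R
      × AllPairs Disjoint R

  toFP* : List (List A) → List (A × A)
  toFP* [] = []
  toFP* ([] ∷ R) = toFP* R
  toFP* ((a ∷ ρ) ∷ R) = toFP a ρ ++ toFP* R

-- Starting from a moved point a, the sequence a, f a, f² a, … stays inside the
-- support and has no repetitions until it returns to a (f is injective), so by
-- pigeonhole cycle_f(N, a) has already closed up.  A closed chain a ∷ ρ is sent
-- by fromFP ∘ toFP to the permutation that agrees with f on it and fixes all
-- other points.  The chains collected by cycles are pairwise disjoint, since a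
-- chain through a point of an earlier, f-invariant chain would end in it and so
-- would start in it; and together they cover the support.  Composing their
-- cycles therefore gives f.
module Submission where

open import Defs
open import Data.Empty using (⊥; ⊥-elim)
open import Data.List using (List; []; _∷_; _++_; _∷ʳ_; concat; length; initLast; _∷ʳ′_)
import Data.List.NonEmpty as List⁺
open import Data.List.Properties using (length-++-sucʳ; length-++)
open import Data.List.Membership.Propositional using (_∈_; _∉_)
open import Data.List.Membership.Propositional.Properties
  using (∈-++⁺ˡ; ∈-++⁺ʳ; ∈-++⁻; ∈-concat⁺′; ∈-concat⁻′; ∈-∃++)
import Data.List.Membership.DecPropositional as DecMembership
open import Data.List.Relation.Binary.Subset.Propositional using (_⊆_)
open import Data.List.Relation.Binary.Disjoint.Propositional using (Disjoint)
open import Data.List.Relation.Binary.Disjoint.Propositional.Properties using (concat⁺ʳ)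
open import Data.List.Relation.Unary.All as All using (All; []; _∷_; lookup)
open import Data.List.Relation.Unary.AllPairs using (AllPairs; []; _∷_)
open import Data.List.Relation.Unary.Any using (here; there)
open import Data.List.Relation.Unary.Linked using (Linked; []; [-]; _∷_)
open import Data.List.Relation.Unary.Unique.Propositional using (Unique)
open import Data.List.Relation.Unary.Unique.Propositional.Properties
  using (Unique[x∷xs]⇒x∉xs) renaming (++⁺ to Unique-++⁺)
open import Data.Nat using (zero; suc; _≤_; z≤n; s≤s)
open import Data.Nat.Properties using (1+n≰n; n≤1+n; ≤-trans; +-comm)
open import Data.Product using (_×_; _,_; ∃₂; proj₁; proj₂)
open import Data.Sum using (_⊎_; inj₁; inj₂)
open import Function using (_∘_)
open import Function.Bundles using (_⇔_; Equivalence)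
open import Function.Definitions using (Bijective; Injective)
open import Relation.Binary.Definitions using (DecidableEquality)
open import Relation.Binary.PropositionalEquality
  using (_≡_; _≢_; _≗_; refl; sym; trans; cong; subst; module ≡-Reasoning)
open import Relation.Nullary using (yes; no)

open ≡-Reasoning

module _ {A : Set} where

  ∈∧∉⇒≢ : ∀ {x y : A} {xs} → x ∈ xs → y ∉ xs → x ≢ y
  ∈∧∉⇒≢ {xs = xs} x∈ y∉ x≡y = y∉ (subst (_∈ xs) x≡y x∈)

  lastOf : A → List A → A
  lastOf c []      = c
  lastOf c (d ∷ τ) = lastOf d τ

  lastOf-∈ : ∀ c τ → lastOf c τ ∈ c ∷ τ
  lastOf-∈ c []      = here refl
  lastOf-∈ c (d ∷ τ) = there (lastOf-∈ d τ)

  lastOf-∷ʳ : ∀ c τ x → lastOf c (τ ∷ʳ x) ≡ x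
  lastOf-∷ʳ c []      x = refl
  lastOf-∷ʳ c (d ∷ τ) x = lastOf-∷ʳ d τ x

  last⁺≡lastOf : ∀ c τ → List⁺.last (c List⁺.∷ τ) ≡ lastOf c τ
  last⁺≡lastOf c τ with initLast τ
  ... | []       = refl
  ... | ys ∷ʳ′ y = sym (lastOf-∷ʳ c ys y)

  ∈-++-∷⁻ : ∀ {x z : A} ys₁ {ys₂} → z ≢ x → z ∈ ys₁ ++ x ∷ ys₂ → z ∈ ys₁ ++ ys₂
  ∈-++-∷⁻ ys₁ z≢x z∈ with ∈-++⁻ ys₁ z∈
  ... | inj₁ z∈ys₁         = ∈-++⁺ˡ z∈ys₁
  ... | inj₂ (here z≡x)    = ⊥-elim (z≢x z≡x)
  ... | inj₂ (there z∈ys₂) = ∈-++⁺ʳ ys₁ z∈ys₂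

  ∉-concat : ∀ {xs : List A} {R} → All (Disjoint xs) R → ∀ {y} → y ∈ xs → y ∉ concat R
  ∉-concat disj y∈xs y∈R = concat⁺ʳ disj (y∈xs , y∈R)

  Unique-⊆⇒length≤ : ∀ {xs ys : List A} → Unique xs → xs ⊆ ys → length xs ≤ length ys
  Unique-⊆⇒length≤ {[]}     _            _     = z≤n
  Unique-⊆⇒length≤ {x ∷ xs} u@(_ ∷ uxs) xs⊆ys with ∈-∃++ (xs⊆ys (here refl))
  ... | ys₁ , ys₂ , refl =
    subst (suc (length xs) ≤_) (sym (length-++-sucʳ ys₁ x ys₂))
      (s≤s (Unique-⊆⇒length≤ uxs xs⊆ys₁++ys₂))
    where
    xs⊆ys₁++ys₂ : xs ⊆ ys₁ ++ ys₂
    xs⊆ys₁++ys₂ z∈ = ∈-++-∷⁻ ys₁ (∈∧∉⇒≢ z∈ (Unique[x∷xs]⇒x∉xs u)) (xs⊆ys (there z∈))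

module _ {A : Set} (_≟_ : DecidableEquality A) where

  open Perm _≟_
  open DecMembership _≟_ using (_∈?_)

  swap-≡ˡ : ∀ x y → swap x y x ≡ y
  swap-≡ˡ x y with x ≟ x
  ... | yes _   = refl
  ... | no x≢x = ⊥-elim (x≢x refl)

  swap-≡ʳ : ∀ x y → swap x y y ≡ x
  swap-≡ʳ x y with y ≟ x
  ... | yes y≡x = y≡x
  ... | no _ with y ≟ y
  ...   | yes _   = refl
  ...   | no y≢y = ⊥-elim (y≢y refl)

  swap-≢ : ∀ {x y z} → z ≢ x → z ≢ y → swap x y z ≡ z
  swap-≢ {x} {y} {z} z≢x z≢y with z ≟ x
  ... | yes z≡x = ⊥-elim (z≢x z≡x)
  ... | no _ with z ≟ y
  ...   | yes z≡y = ⊥-elim (z≢y z≡y)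
  ...   | no _    = refl

  fromFP-++ : ∀ xs ys → fromFP (xs ++ ys) ≗ fromFP xs ∘ fromFP ys
  fromFP-++ []             ys z = refl
  fromFP-++ ((a , b) ∷ xs) ys z = cong (swap a b) (fromFP-++ xs ys z)

  fromFP-toFP-∉ : ∀ a ρ {x} → x ∉ a ∷ ρ → fromFP (toFP a ρ) x ≡ x
  fromFP-toFP-∉ a []      x∉ = refl
  fromFP-toFP-∉ a (b ∷ ρ) {x} x∉ = begin
    swap a b (fromFP (toFP b ρ) x) ≡⟨ cong (swap a b) (fromFP-toFP-∉ b ρ (x∉ ∘ there)) ⟩
    swap a b x                     ≡⟨ swap-≢ (x∉ ∘ here) (x∉ ∘ there ∘ here) ⟩
    x                              ∎

  fromFP-toFP-lastOf : ∀ a ρ → fromFP (toFP a ρ) (lastOf a ρ) ≡ a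
  fromFP-toFP-lastOf a []      = refl
  fromFP-toFP-lastOf a (b ∷ ρ) =
    trans (cong (swap a b) (fromFP-toFP-lastOf b ρ)) (swap-≡ʳ a b)

  fromFP-toFP*-∉ : ∀ R {x} → x ∉ concat R → fromFP (toFP* R) x ≡ x
  fromFP-toFP*-∉ []            x∉ = refl
  fromFP-toFP*-∉ ([] ∷ R)      x∉ = fromFP-toFP*-∉ R x∉
  fromFP-toFP*-∉ ((a ∷ ρ) ∷ R) {x} x∉ = begin
    fromFP (toFP a ρ ++ toFP* R) x
      ≡⟨ fromFP-++ (toFP a ρ) (toFP* R) x ⟩
    fromFP (toFP a ρ) (fromFP (toFP* R) x)
      ≡⟨ cong (fromFP (toFP a ρ)) (fromFP-toFP*-∉ R (x∉ ∘ ∈-++⁺ʳ (a ∷ ρ))) ⟩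
    fromFP (toFP a ρ) x
      ≡⟨ fromFP-toFP-∉ a ρ (x∉ ∘ ∈-++⁺ˡ) ⟩
    x ∎

  module _ (f : A → A) where

    Chain : List A → Set
    Chain = Linked (λ x y → f x ≡ y)

    Chain-∷ʳ : ∀ {c τ x} → Chain (c ∷ τ) → f (lastOf c τ) ≡ x → Chain (c ∷ (τ ∷ʳ x))
    Chain-∷ʳ {τ = []}    _           fc≡x = fc≡x ∷ [-]
    Chain-∷ʳ {τ = _ ∷ _} (fc≡d ∷ ch) fl≡x = fc≡d ∷ Chain-∷ʳ ch fl≡x

    Chain-successor∈ : ∀ {c τ x} → Chain (c ∷ τ) → x ∈ c ∷ τ → x ≢ lastOf c τ → f x ∈ τ
    Chain-successor∈ {τ = []}    _           (here refl) x≢l = ⊥-elim (x≢l refl)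
    Chain-successor∈ {τ = _ ∷ _} (fc≡d ∷ _)  (here refl) _   = here fc≡d
    Chain-successor∈ {τ = _ ∷ _} (_ ∷ ch)    (there x∈)  x≢l = there (Chain-successor∈ ch x∈ x≢l)

    Chain-reaches-lastOf : ∀ (S : A → Set) → (∀ {z} → S z → S (f z)) →
                           ∀ {c τ y} → Chain (c ∷ τ) → y ∈ c ∷ τ → S y → S (lastOf c τ)
    Chain-reaches-lastOf S f-pres {τ = []}    _           (here refl) Sy = Sy
    Chain-reaches-lastOf S f-pres {τ = _ ∷ _} (fc≡d ∷ ch) (here refl) Sy =
      Chain-reaches-lastOf S f-pres ch (here refl) (subst S fc≡d (f-pres Sy))
    Chain-reaches-lastOf S f-pres {τ = _ ∷ _} (_ ∷ ch)    (there y∈)  Sy =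
      Chain-reaches-lastOf S f-pres ch y∈ Sy

    fromFP-toFP-Chain : ∀ a ρ → Chain (a ∷ ρ) → Unique (a ∷ ρ) →
                        ∀ {x} → x ∈ a ∷ ρ → x ≢ lastOf a ρ → fromFP (toFP a ρ) x ≡ f x
    fromFP-toFP-Chain a []      _ _ (here refl) x≢l = ⊥-elim (x≢l refl)
    fromFP-toFP-Chain a (b ∷ ρ) (fa≡b ∷ _) u (here refl) _ = begin
      swap a b (fromFP (toFP b ρ) a) ≡⟨ cong (swap a b) (fromFP-toFP-∉ b ρ (Unique[x∷xs]⇒x∉xs u)) ⟩
      swap a b a                     ≡⟨ swap-≡ˡ a b ⟩
      b                              ≡⟨ sym fa≡b ⟩
      f a                            ∎
    fromFP-toFP-Chain a (b ∷ ρ) (_ ∷ ch) u@(_ ∷ ub) {x} (there x∈) x≢l = begin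
      swap a b (fromFP (toFP b ρ) x) ≡⟨ cong (swap a b) (fromFP-toFP-Chain b ρ ch ub x∈ x≢l) ⟩
      swap a b (f x)                 ≡⟨ swap-≢ fx≢a fx≢b ⟩
      f x                            ∎
      where
      fx∈ρ : f x ∈ ρ
      fx∈ρ = Chain-successor∈ ch x∈ x≢l
      fx≢a : f x ≢ a
      fx≢a = ∈∧∉⇒≢ (there fx∈ρ) (Unique[x∷xs]⇒x∉xs u)
      fx≢b : f x ≢ b
      fx≢b = ∈∧∉⇒≢ fx∈ρ (Unique[x∷xs]⇒x∉xs ub)

    -- A closed prefix ρ with head a (kept together with a), strengthened to be repetition-free.
    record ClosedChain (a : A) (ρ : List A) : Set where
      field
        moved  : InSupp f a
        chain  : Chain (a ∷ ρ)
        unique : Unique (a ∷ ρ)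
        closes : f (lastOf a ρ) ≡ a

    IsOrbit : List A → Set
    IsOrbit []      = ⊥
    IsOrbit (a ∷ ρ) = ClosedChain a ρ

    IsOrbit-f-closed : ∀ {e} → IsOrbit e → ∀ {x} → x ∈ e → f x ∈ e
    IsOrbit-f-closed {a ∷ ρ} orb {x} x∈ with x ≟ lastOf a ρ
    ... | yes refl = here (ClosedChain.closes orb)
    ... | no x≢l   = there (Chain-successor∈ (ClosedChain.chain orb) x∈ x≢l)

    IsOrbit⇒closedPrefix : ∀ {e} → IsOrbit e → ∃₂ λ a ρ → (e ≡ a ∷ ρ) × IsClosedPrefix f a ρ
    IsOrbit⇒closedPrefix {a ∷ ρ} orb with initLast ρ
    ... | [] = ⊥-elim (moved closes)
      where open ClosedChain orb
    ... | ys ∷ʳ′ y =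
      a , ys ∷ʳ y , refl , (ρ≢[] ys , moved , chain , Unique[x∷xs]⇒x∉xs unique)
        , ys , y , refl , trans (cong f (sym (lastOf-∷ʳ a ys y))) closes
      where
      open ClosedChain orb
      ρ≢[] : ∀ zs → zs ∷ʳ y ≢ []
      ρ≢[] []      ()
      ρ≢[] (_ ∷ _) ()

    fromFP-toFP-ClosedChain : ∀ {a ρ} → ClosedChain a ρ → ∀ {x} → x ∈ a ∷ ρ →
                              fromFP (toFP a ρ) x ≡ f x
    fromFP-toFP-ClosedChain {a} {ρ} orb {x} x∈ with x ≟ lastOf a ρ
    ... | yes refl = trans (fromFP-toFP-lastOf a ρ) (sym closes)
      where open ClosedChain orb
    ... | no x≢l   = fromFP-toFP-Chain a ρ chain unique x∈ x≢l
      where open ClosedChain orb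

    OrbitList : List (List A) → Set
    OrbitList R = All IsOrbit R × AllPairs Disjoint R

    OrbitList-f-closed : ∀ {R} → All IsOrbit R → ∀ {x} → x ∈ concat R → f x ∈ concat R
    OrbitList-f-closed {R} orbits x∈ with ∈-concat⁻′ R x∈
    ... | e , x∈e , e∈R = ∈-concat⁺′ (IsOrbit-f-closed (lookup orbits e∈R) x∈e) e∈R

    fromFP-toFP*-∈ : ∀ {R} → OrbitList R → ∀ {x} → x ∈ concat R → fromFP (toFP* R) x ≡ f x
    fromFP-toFP*-∈ {(a ∷ ρ) ∷ R} (orb ∷ orbits , disj ∷ disjoint) {x} x∈
      rewrite fromFP-++ (toFP a ρ) (toFP* R) x with ∈-++⁻ (a ∷ ρ) x∈
    ... | inj₁ x∈aρ = begin
      fromFP (toFP a ρ) (fromFP (toFP* R) x)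
        ≡⟨ cong (fromFP (toFP a ρ)) (fromFP-toFP*-∉ R (∉-concat disj x∈aρ)) ⟩
      fromFP (toFP a ρ) x
        ≡⟨ fromFP-toFP-ClosedChain orb x∈aρ ⟩
      f x ∎
    ... | inj₂ x∈R = begin
      fromFP (toFP a ρ) (fromFP (toFP* R) x)
        ≡⟨ cong (fromFP (toFP a ρ)) (fromFP-toFP*-∈ (orbits , disjoint) x∈R) ⟩
      fromFP (toFP a ρ) (f x)
        ≡⟨ fromFP-toFP-∉ a ρ (λ fx∈aρ → ∉-concat disj fx∈aρ (OrbitList-f-closed orbits x∈R)) ⟩
      f x ∎

    fromFP-toFP*≗f : ∀ {R} → OrbitList R → (∀ {x} → InSupp f x → x ∈ concat R) →
                     fromFP (toFP* R) ≗ f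
    fromFP-toFP*≗f {R} orbitList supp⊆R x with x ∈? concat R | f x ≟ x
    ... | yes x∈R | _      = fromFP-toFP*-∈ orbitList x∈R
    ... | no x∉R  | yes fx≡x = trans (fromFP-toFP*-∉ R x∉R) (sym fx≡x)
    ... | no x∉R  | no fx≢x  = ⊥-elim (x∉R (supp⊆R fx≢x))

    cycles-⊇ : ∀ n as R {x} → x ∈ concat R → x ∈ concat (cycles f n as R)
    cycles-⊇ n []       R x∈ = x∈
    cycles-⊇ n (a ∷ as) R x∈ with a ∈? concat R
    ... | yes _ = cycles-⊇ n as R x∈
    ... | no _  = cycles-⊇ n as _ (∈-++⁺ʳ (a ∷ _) x∈)

    cycles-covers : ∀ n as R {x} → x ∈ as → x ∈ concat (cycles f n as R)
    cycles-covers n (a ∷ as) R (here refl) with a ∈? concat R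
    ... | yes a∈R = cycles-⊇ n as R a∈R
    ... | no _    = cycles-⊇ n as _ (here refl)
    cycles-covers n (a ∷ as) R (there x∈) with a ∈? concat R
    ... | yes _ = cycles-covers n as R x∈
    ... | no _  = cycles-covers n as _ x∈

    ClosedChain-disjoint : ∀ {a ρ R} → ClosedChain a ρ → a ∉ concat R → All IsOrbit R →
                           All (Disjoint (a ∷ ρ)) R
    ClosedChain-disjoint {a} {ρ} orb a∉R orbits = All.tabulate λ {e} e∈R (y∈aρ , y∈e) →
      let e-closed = IsOrbit-f-closed (lookup orbits e∈R)
          l∈e      = Chain-reaches-lastOf (_∈ e) e-closed (ClosedChain.chain orb) y∈aρ y∈e
      in a∉R (∈-concat⁺′ (subst (_∈ e) (ClosedChain.closes orb) (e-closed l∈e)) e∈R)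

    module _ (f-injective : Injective _≡_ _≡_ f) where

      InSupp-f : ∀ {x} → InSupp f x → InSupp f (f x)
      InSupp-f x-moved = x-moved ∘ f-injective

      Chain⇒InSupp : ∀ {c τ} → Chain (c ∷ τ) → InSupp f c → All (InSupp f) (c ∷ τ)
      Chain⇒InSupp {τ = []}    _           c-moved = c-moved ∷ []
      Chain⇒InSupp {τ = _ ∷ _} (fc≡d ∷ ch) c-moved =
        c-moved ∷ Chain⇒InSupp ch (subst (InSupp f) fc≡d (InSupp-f c-moved))

      Chain-f-lastOf∉tail : ∀ {c τ} → Chain (c ∷ τ) → Unique (c ∷ τ) → f (lastOf c τ) ∉ τ
      Chain-f-lastOf∉tail {c} {d ∷ τ} (fc≡d ∷ _) u (here fl≡d) =
        ∈∧∉⇒≢ (lastOf-∈ d τ) (Unique[x∷xs]⇒x∉xs u) (f-injective (trans fl≡d (sym fc≡d)))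
      Chain-f-lastOf∉tail {c} {d ∷ τ} (_ ∷ ch) (_ ∷ ud) (there fl∈τ) =
        Chain-f-lastOf∉tail ch ud fl∈τ

      Chain-extend : ∀ {a ρ} → Chain (a ∷ ρ) → Unique (a ∷ ρ) → f (lastOf a ρ) ≢ a →
                     let x = f (lastOf a ρ) in Chain (a ∷ (ρ ∷ʳ x)) × Unique (a ∷ (ρ ∷ʳ x))
      Chain-extend {a} {ρ} ch u fl≢a =
        Chain-∷ʳ ch refl ,
        Unique-++⁺ u ([] ∷ []) λ where (fl∈ , here refl) → fl∉ fl∈
        where
        fl∉ : f (lastOf a ρ) ∉ a ∷ ρ
        fl∉ (here fl≡a)  = fl≢a fl≡a
        fl∉ (there fl∈ρ) = Chain-f-lastOf∉tail ch u fl∈ρ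

      cycle-invariant : ∀ n a → InSupp f a → let ρ = List⁺.toList (cycle f n a) in
                        Chain (a ∷ ρ) × Unique (a ∷ ρ) × (f (lastOf a ρ) ≡ a ⊎ length ρ ≡ suc n)
      cycle-invariant zero    a a-moved = refl ∷ [-] , ((a-moved ∘ sym) ∷ []) ∷ [] ∷ [] , inj₂ refl
      cycle-invariant (suc n) a a-moved with cycle f n a | cycle-invariant n a a-moved
      ... | c List⁺.∷ τ | ch , u , closed-or-long with f (List⁺.last (c List⁺.∷ τ)) ≟ a
      ...   | yes fl≡a = ch , u , inj₁ (trans (cong f (sym (last⁺≡lastOf c τ))) fl≡a)
      ...   | no fl≢a rewrite last⁺≡lastOf c τ =
        let ch′ , u′ = Chain-extend ch u fl≢a in ch′ , u′ , inj₂ (grown closed-or-long)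
        where
        grown : f (lastOf c τ) ≡ a ⊎ length (c ∷ τ) ≡ suc n →
                length (c ∷ (τ ∷ʳ f (lastOf c τ))) ≡ suc (suc n)
        grown (inj₁ fl≡a) = ⊥-elim (fl≢a fl≡a)
        grown (inj₂ len)  = cong suc (trans (length-++ τ) (trans (+-comm (length τ) 1) len))

      module _ {s : List A} (supp⊆s : ∀ {x} → InSupp f x → x ∈ s) where

        cycle-ClosedChain : ∀ {a} → InSupp f a →
                            ClosedChain a (List⁺.toList (cycle f (length s) a))
        cycle-ClosedChain {a} a-moved with cycle-invariant (length s) a a-moved
        ... | ch , u , inj₁ closes =
          record { moved = a-moved ; chain = ch ; unique = u ; closes = closes }
        ... | ch , u , inj₂ len    = ⊥-elim (1+n≰n (≤-trans (n≤1+n _) too-long))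
          where
          too-long : suc (suc (length s)) ≤ length s
          too-long = subst (λ k → suc k ≤ length s) len
            (Unique-⊆⇒length≤ u (λ x∈ → supp⊆s (lookup (Chain⇒InSupp ch a-moved) x∈)))

        cycles-OrbitList : ∀ {as R} → All (InSupp f) as → OrbitList R →
                           OrbitList (cycles f (length s) as R)
        cycles-OrbitList {[]}     _ orbitList = orbitList
        cycles-OrbitList {a ∷ as} {R} (a-moved ∷ as-moved) (orbits , disjoint) with a ∈? concat R
        ... | yes _  = cycles-OrbitList as-moved (orbits , disjoint)
        ... | no a∉R  = cycles-OrbitList as-moved
          (orb ∷ orbits , ClosedChain-disjoint orb a∉R orbits ∷ disjoint)
          where orb = cycle-ClosedChain a-moved

theorem1 : {A : Set} (_≟_ : DecidableEquality A) (f : A → A)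
    → Bijective _≡_ _≡_ f
    → (s : List A) → Unique s → (∀ x → (x ∈ s) ⇔ Perm.InSupp _≟_ f x)
    → let R = Perm.cycles _≟_ f (length s) s [] in
    Perm.IsClosedPrefixList _≟_ f R
    × (∀ a → Perm.fromFP _≟_ (Perm.toFP* _≟_ R) a ≡ f a)
theorem1 _≟_ f (f-injective , _) s _ s⇔supp =
  (All.map (IsOrbit⇒closedPrefix _≟_ f) orbits , disjoint) ,
  fromFP-toFP*≗f _≟_ f (orbits , disjoint) (cycles-covers _≟_ f (length s) s [] ∘ supp⊆s)
  where
  supp⊆s : ∀ {x} → Perm.InSupp _≟_ f x → x ∈ s
  supp⊆s {x} = Equivalence.from (s⇔supp x)

  s-moved : All (Perm.InSupp _≟_ f) s
  s-moved = All.tabulate λ {x} → Equivalence.to (s⇔supp x)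

  orbitList : OrbitList _≟_ f (Perm.cycles _≟_ f (length s) s [])
  orbitList = cycles-OrbitList _≟_ f f-injective supp⊆s s-moved ([] , [])

  orbits : All (IsOrbit _≟_ f) (Perm.cycles _≟_ f (length s) s [])
  orbits = proj₁ orbitList

  disjoint : AllPairs Disjoint (Perm.cycles _≟_ f (length s) s [])
  disjoint = proj₂ orbitList
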